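{- Let $T = (V,E)$ be a finite simple undirected tree. For all $u,v \in V$ with $\mathrm{dist}(u,v) \geq 3$, the inequality $$x_{uv} + x_{\vec{u}(v),\vec{v}(u)} \leq x_{u,\vec{v}(u)} + x_{\vec{u}(v),v}$$ defines a facet of $\Xi_T$.
   Context: Let $m = |\binom{V}{2}|$. Vectors $x \in \mathbb{R}^m$ have coordinates $x_{uv} = x_{vu}$ indexed by unordered pairs of distinct nodes; for an edge $e = \{u,v\} \in E$ write $x_e = x_{uv}$. $P_{uv}$ is the unique path in $T$ from $u$ to $v$ and $\mathrm{dist}(u,v)$ its number of edges. $X_T$ is the set of all $x \in \{0,1\}^m$ such that for all $u,v$ with $\mathrm{dist}(u,v) \geq 2$: $x_{uv} \leq \sum_{e \in P_{uv}} x_e$, and $x_e \leq x_{uv}$ for every $e \in P_{uv}$. The lifted multicut polytope is $\Xi_T = \operatorname{conv} X_T$ (it has dimension $m$). For $u,v$ with $\mathrm{dist}(u,v) \geq 2$, $\vec{u}(v)$ denotes the neighbor of $u$ on $P_{uv}$ and $\vec{v}(u)$ the neighbor of $v$ on $P_{uv}$. -}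

module Defs where

open import Data.Nat using (ℕ; zero; suc; _+_; _∸_; _≤_)
open import Data.Nat.Combinatorics using (_C_)
open import Data.Bool using (Bool; true; false)
open import Data.Fin using (Fin; zero; suc)
open import Data.List using (List; []; _∷_; [_]; length; map)
open import Data.Nat.ListAction using (sum)
open import Data.List.Relation.Unary.All using (All)
open import Data.List.Relation.Unary.Unique.Propositional using (Unique)
open import Data.Product using (Σ; ∃; _×_; _,_)
open import Data.Rational using (ℚ; 0ℚ; 1ℚ; _*_) renaming (_+_ to _+ℚ_)
open import Relation.Binary.PropositionalEquality using (_≡_; _≢_)

data Walk {n : ℕ} (adj : Fin n → Fin n → Bool) : Fin n → Fin n → List (Fin n) → Set where
  single : ∀ {u} → Walk adj u u [ u ]
  step   : ∀ {u w v p} → adj u w ≡ true → Walk adj w v p → Walk adj u v (u ∷ p)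

IsPath : {n : ℕ} → (Fin n → Fin n → Bool) → Fin n → Fin n → List (Fin n) → Set
IsPath adj u v p = Walk adj u v p × Unique p

nEdges : {A : Set} → List A → ℕ
nEdges p = length p ∸ 1

edgesOf : {A : Set} → List A → List (A × A)
edgesOf []           = []
edgesOf (a ∷ [])     = []
edgesOf (a ∷ b ∷ p)  = (a , b) ∷ edgesOf (b ∷ p)

record Tree (n : ℕ) : Set where
  field
    adj      : Fin n → Fin n → Bool
    sym      : ∀ u v → adj u v ≡ adj v u
    irrefl   : ∀ u → adj u u ≡ false
    connected : ∀ u v → ∃ λ p → IsPath adj u v p
    unique   : ∀ u v p q → IsPath adj u v p → IsPath adj u v q → p ≡ q

-- Points of {0,1}^m, m = |(V choose 2)|: x u v for unordered pairs {u,v},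
-- u ≠ v; represented as symmetric functions with the (irrelevant)
-- diagonal fixed to false.
Point : ℕ → Set
Point n = Fin n → Fin n → Bool

b2n : Bool → ℕ
b2n true  = 1
b2n false = 0

b2q : Bool → ℚ
b2q true  = 1ℚ
b2q false = 0ℚ

InX : {n : ℕ} → Tree n → Point n → Set
InX {n} T x =
    (∀ u v → x u v ≡ x v u)
  × (∀ u → x u u ≡ false)
  × (∀ u v p → IsPath (Tree.adj T) u v p → 2 ≤ nEdges p →
        (b2n (x u v) ≤ sum (map (λ { (a , b) → b2n (x a b) }) (edgesOf p)))
      × All (λ { (a , b) → b2n (x a b) ≤ b2n (x u v) }) (edgesOf p))

sumℚ : (k : ℕ) → (Fin k → ℚ) → ℚ
sumℚ zero    f = 0ℚ
sumℚ (suc k) f = f zero +ℚ sumℚ k (λ i → f (suc i))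

-- Affine independence of k points of ℝ^m (all coordinates rational,
-- so ℚ-coefficients suffice): the only λ with Σ λᵢ = 0 and
-- Σ λᵢ pᵢ = 0 (on every coordinate {u,v}, u ≠ v) is λ = 0.
AffinelyIndependent : {n : ℕ} (k : ℕ) → (Fin k → Point n) → Set
AffinelyIndependent {n} k p =
  (c : Fin k → ℚ) → sumℚ k c ≡ 0ℚ →
  (∀ (u v : Fin n) → u ≢ v → sumℚ k (λ i → c i * b2q (p i u v)) ≡ 0ℚ) →
  ∀ i → c i ≡ 0ℚ

-- The inequality  f x ≤ g x  (f, g linear in x) defines a facet of
-- Ξ_T = conv X_T (a polytope of dimension m = n C 2):
--  * it is valid for X_T (hence for conv X_T),
--  * the face it defines is proper (some point of X_T is not tight),
--  * the face has dimension m - 1: it contains m affinely independent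
--    points of X_T (the face equals conv of the tight points of X_T).
FacetDefining : {n : ℕ} → Tree n → (Point n → ℕ) → (Point n → ℕ) → Set
FacetDefining {n} T f g =
    (∀ x → InX T x → f x ≤ g x)
  × (∃ λ x → InX T x × f x ≢ g x)
  × (Σ (Fin (n C 2) → Point n) λ p →
        (∀ i → InX T (p i)) × (∀ i → f (p i) ≡ g (p i))
      × AffinelyIndependent (n C 2) p)

-- Validity: if x separates u′ and v′, some edge of the path u′ … v′ is cut, and that edge lies on
-- both paths u … v′ and u′ … v; if x separates u and v, the cut edge of u … v lies on one of them.
--
-- Facet: for a convex set W of nodes, the multicut whose only non-singleton component is W lies in
-- X_T, and it is tight unless W contains u′ and v′ but neither u nor v. Every pair {a, b} gets such
-- a point with a, b ∈ W: W is the path from a to b, extended by the pendant node u (or v) when the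
-- path alone would not be tight, and W = ∅ for {u′, v′}. Ordering the pairs by |P_ab| + |W_ab|,
-- the Boolean matrix "point j puts both ends of pair i into one component" is triangular with unit
-- diagonal, except for the all-ones point of {u′, v′}, whose row is zero; together with Σ λ = 0
-- this forces every coefficient of an affine dependence to vanish.

{-# OPTIONS --safe #-}
module Submission where

open import Defs
open import Data.Nat using (ℕ; _+_; _≤_)
open import Data.Fin using (Fin)
open import Data.List using (List; _∷_; _++_; [_])

import Algebra.Properties.CommutativeMonoid.Sum
open import Data.Bool using (Bool; true; false; not; _∧_; _∨_)
open import Data.Bool.Properties
  using (∧-comm; ∨-zeroʳ; ∨-identityʳ; ∧-conicalˡ; ∧-conicalʳ; not-involutive)
open import Data.Empty using (⊥; ⊥-elim)
open import Data.Fin using (zero; suc; _≟_; toℕ; inject₁; fromℕ; splitAt; join; cast; punchIn)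
open import Data.Fin.Properties
  using ( toℕ<n; toℕ-inject₁; toℕ-fromℕ; inject₁-injective; fromℕ≢inject₁; join-splitAt
        ; cast-involutive; punchInᵢ≢i; suc-injective)
open import Data.List using ([]; map; length; reverse; _∷ʳ_)
open import Data.List.Properties using (unfold-reverse; ++-assoc)
open import Data.List.Membership.Propositional using (_∈_; _∉_)
open import Data.List.Membership.Propositional.Properties using (∈-++⁺ʳ)
open import Data.List.Relation.Binary.Permutation.Propositional using (↭-sym; ↭⇒↭ₛ′)
open import Data.List.Relation.Binary.Permutation.Propositional.Properties using (↭-reverse)
import Data.List.Relation.Binary.Permutation.Setoid.Properties as Permutation
open import Data.List.Relation.Binary.Subset.Propositional using (_⊆_)
open import Data.List.Relation.Unary.All as All using (All; _∷_; [])
import Data.List.Relation.Unary.All.Properties as All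
open import Data.List.Relation.Unary.Any using (here; there)
open import Data.List.Relation.Unary.Any.Properties using (reverse⁺; reverse⁻)
open import Data.List.Relation.Unary.Unique.Propositional using (Unique; _∷_; [])
open import Data.List.Relation.Unary.Unique.Propositional.Properties using (Unique[x∷xs]⇒x∉xs)
open import Data.Nat using (zero; suc; _<_; s≤s; s≤s⁻¹; z≤n)
open import Data.Nat.Combinatorics using (_C_; nC1≡n; nCk+nC[k+1]≡[n+1]C[k+1])
open import Data.Nat.ListAction using (sum)
open import Data.Nat.Properties
  using ( ≤-trans; n≤1+n; m≤m+n; m≤n+m; +-suc; +-monoˡ-≤; +-mono-≤; +-mono-<
        ; +-mono-<-≤; +-mono-≤-<; <⇒≱; <-≤-trans; <-irrefl; <-asym)
import Data.Nat.Properties as ℕ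
import Data.Product as Product
open import Data.Product using (∃; ∃₂; _×_; _,_; proj₁; proj₂; uncurry)
open import Data.Rational using (ℚ; 0ℚ; 1ℚ; _*_) renaming (_+_ to _+ℚ_)
open import Data.Rational.Properties
  using (+-0-commutativeMonoid; +-identityˡ; +-identityʳ; *-identityʳ; *-zeroˡ; *-zeroʳ)
open import Data.Sum using (_⊎_; inj₁; inj₂)
open import Data.Vec.Functional using (removeAt; replicate)
open import Function using (_∘_; case_of_)
open import Relation.Nullary using (¬_; yes; no; does; Dec)
open import Relation.Nullary.Decidable using (dec-true; dec-false; _×-dec_; _⊎-dec_; ¬?)
open import Relation.Binary.PropositionalEquality
  using ( _≡_; _≢_; refl; sym; trans; cong; cong₂; subst; ≢-sym; setoid; isEquivalence
        ; module ≡-Reasoning)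

module ℚSum = Algebra.Properties.CommutativeMonoid.Sum +-0-commutativeMonoid

module _ {A : Set} where

  Unique-reverse : {xs : List A} → Unique xs → Unique (reverse xs)
  Unique-reverse {xs} =
    Permutation.Unique-resp-↭ (setoid A) (↭⇒↭ₛ′ isEquivalence (↭-sym (↭-reverse xs)))

  Unique-prefix : ∀ xs {y : A} {ys} → Unique (xs ++ y ∷ ys) → Unique (xs ++ [ y ])
  Unique-prefix []       (_ ∷ _)   = [] ∷ []
  Unique-prefix (x ∷ xs) (x∉ ∷ u) =
    All.++⁺ (All.++⁻ˡ xs x∉) (All.head (All.++⁻ʳ xs x∉) ∷ []) ∷ Unique-prefix xs u

  Unique-++⇒∉ : ∀ xs {ys : List A} {y} → Unique (xs ++ ys) → y ∈ ys → y ∉ xs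
  Unique-++⇒∉ (x ∷ xs) (x∉ ∷ _) y∈ys (here refl)  = All.lookup x∉ (∈-++⁺ʳ xs y∈ys) refl
  Unique-++⇒∉ (x ∷ xs) (_ ∷ u)  y∈ys (there y∈xs) = Unique-++⇒∉ xs u y∈ys y∈xs

  Unique-suffix : ∀ xs {ys : List A} → Unique (xs ++ ys) → Unique ys
  Unique-suffix []       u       = u
  Unique-suffix (_ ∷ xs) (_ ∷ u) = Unique-suffix xs u

  Unique-last∉ : ∀ xs {y z : A} → Unique (xs ++ y ∷ [ z ]) → z ∉ xs ++ [ y ]
  Unique-last∉ xs {y} {z} u =
    Unique-++⇒∉ (xs ++ [ y ]) (subst Unique (sym (++-assoc xs [ y ] [ z ])) u) (here refl)

  ∉-∈⇒≢ : ∀ {x y : A} {xs} → x ∉ xs → y ∈ xs → x ≢ y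
  ∉-∈⇒≢ x∉ y∈ refl = x∉ y∈

  ⊆-∷⁻ : ∀ {z : A} {xs ys} → xs ⊆ z ∷ ys → z ∉ xs → xs ⊆ ys
  ⊆-∷⁻ xs⊆ z∉ x∈ with xs⊆ x∈
  ... | here refl  = ⊥-elim (z∉ x∈)
  ... | there x∈ys = x∈ys

  ∈-edgesOf⇒∈ : ∀ {a b : A} {p} → (a , b) ∈ edgesOf p → a ∈ p × b ∈ p
  ∈-edgesOf⇒∈ {p = _ ∷ _ ∷ _} (here refl) = here refl , there (here refl)
  ∈-edgesOf⇒∈ {p = _ ∷ _ ∷ _} (there e∈) with ∈-edgesOf⇒∈ e∈
  ... | a∈ , b∈ = there a∈ , there b∈

  edgesOf-Unique⇒≢ : ∀ {a b : A} {p} → Unique p → (a , b) ∈ edgesOf p → a ≢ b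
  edgesOf-Unique⇒≢ {p = _ ∷ _ ∷ _} ((a≢b ∷ _) ∷ _) (here refl) = a≢b
  edgesOf-Unique⇒≢ {p = _ ∷ _ ∷ _} (_ ∷ u)          (there e∈)  = edgesOf-Unique⇒≢ u e∈

  incident-edge : ∀ {a b x : A} {r} → x ∈ a ∷ b ∷ r →
    ∃ λ y → (x , y) ∈ edgesOf (a ∷ b ∷ r) ⊎ (y , x) ∈ edgesOf (a ∷ b ∷ r)
  incident-edge {a} {b}     (here refl)         = b , inj₁ (here refl)
  incident-edge {a}         (there (here refl)) = a , inj₂ (here refl)
  incident-edge {r = _ ∷ _} (there (there x∈)) with incident-edge (there x∈)
  ... | y , inj₁ e∈ = y , inj₁ (there e∈)
  ... | y , inj₂ e∈ = y , inj₂ (there e∈)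

  edgesOf-prefix : ∀ xs {y : A} {ys e} → e ∈ edgesOf (xs ++ [ y ]) → e ∈ edgesOf (xs ++ y ∷ ys)
  edgesOf-prefix (_ ∷ [])     (here refl) = here refl
  edgesOf-prefix (_ ∷ _ ∷ _)  (here refl) = here refl
  edgesOf-prefix (_ ∷ x ∷ xs) (there e∈)  = there (edgesOf-prefix (x ∷ xs) e∈)

≤-sum-map : ∀ {A : Set} (f : A → ℕ) {e es} → e ∈ es → f e ≤ sum (map f es)
≤-sum-map f {es = x ∷ xs} (here refl) = m≤m+n (f x) _
≤-sum-map f {es = x ∷ xs} (there e∈) = ≤-trans (≤-sum-map f e∈) (m≤n+m _ (f x))

b2n≤1 : ∀ b → b2n b ≤ 1
b2n≤1 true  = s≤s z≤n
b2n≤1 false = z≤n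

b2n-true : ∀ {b} → b ≡ true → 1 ≤ b2n b
b2n-true refl = s≤s z≤n

b2n-pos : ∀ {b} → 1 ≤ b2n b → b ≡ true
b2n-pos {true} _ = refl

sum-pos : ∀ {A : Set} (f : A → ℕ) es → 1 ≤ sum (map f es) → ∃ λ e → e ∈ es × 1 ≤ f e
sum-pos f (e ∷ es) 1≤ with f e in fe
... | suc _ = e , here refl , subst (1 ≤_) (sym fe) (s≤s z≤n)
... | 0 with sum-pos f es 1≤
...   | e′ , e′∈ , 1≤fe′ = e′ , there e′∈ , 1≤fe′

module Walks {n : ℕ} (adj : Fin n → Fin n → Bool) (adj-sym : ∀ a b → adj a b ≡ adj b a) where

  Path : Fin n → Fin n → List (Fin n) → Set
  Path = IsPath adj

  walk-start∈ : ∀ {a b p} → Walk adj a b p → a ∈ p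
  walk-start∈ single     = here refl
  walk-start∈ (step _ _) = here refl

  walk-end∈ : ∀ {a b p} → Walk adj a b p → b ∈ p
  walk-end∈ single     = here refl
  walk-end∈ (step _ w) = there (walk-end∈ w)

  walk-∷ʳ : ∀ {a b c p} → Walk adj a b p → adj b c ≡ true → Walk adj a c (p ∷ʳ c)
  walk-∷ʳ single     e = step e single
  walk-∷ʳ (step e′ w) e = step e′ (walk-∷ʳ w e)

  walk-reverse : ∀ {a b p} → Walk adj a b p → Walk adj b a (reverse p)
  walk-reverse single = single
  walk-reverse {a} (step {w = w} {p = p} e wk) rewrite unfold-reverse a p =
    walk-∷ʳ (walk-reverse wk) (trans (adj-sym w a) e)

  path-reverse : ∀ {a b p} → Path a b p → Path b a (reverse p)
  path-reverse (w , u) = walk-reverse w , Unique-reverse u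

  walk-prefix : ∀ xs {a b y ys} → Walk adj a b (xs ++ y ∷ ys) → Walk adj a y (xs ++ [ y ])
  walk-prefix []           single     = single
  walk-prefix []           (step _ _) = single
  walk-prefix (_ ∷ [])     (step e w) = step e (walk-prefix [] w)
  walk-prefix (_ ∷ x ∷ xs) (step e w) = step e (walk-prefix (x ∷ xs) w)

  walk-suffix : ∀ xs {a b y ys} → Walk adj a b (xs ++ y ∷ ys) → Walk adj y b (y ∷ ys)
  walk-suffix []           single     = single
  walk-suffix []           (step e w) = step e w
  walk-suffix (_ ∷ [])     (step _ w) = walk-suffix [] w
  walk-suffix (_ ∷ x ∷ xs) (step _ w) = walk-suffix (x ∷ xs) w

  walk-length : ∀ {a b p} → Walk adj a b p → 1 ≤ length p
  walk-length single     = s≤s z≤n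
  walk-length (step _ _) = s≤s z≤n

  walk-head-adj : ∀ {a b c r} → Walk adj a b (a ∷ c ∷ r) → adj a c ≡ true
  walk-head-adj (step e single)     = e
  walk-head-adj (step e (step _ _)) = e

  path-suffix : ∀ xs {a b y ys} → Path a b (xs ++ y ∷ ys) → Path y b (y ∷ ys)
  path-suffix xs (w , u) = walk-suffix xs w , Unique-suffix xs u

  path-prefix : ∀ xs {a b y ys} → Path a b (xs ++ y ∷ ys) → Path a y (xs ++ [ y ])
  path-prefix xs (w , u) = walk-prefix xs w , Unique-prefix xs u

  path-to : ∀ {a b d L} → Path a b L → d ∈ L →
    ∃ λ p → Path a d p × p ⊆ L × (b ∈ p → d ≡ b)
  path-to (single , _) (here refl) = [ _ ] , (single , [] ∷ []) , (λ x∈ → x∈) , λ _ → refl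
  path-to (step _ _ , _) (here refl) =
    [ _ ] , (single , [] ∷ []) , (λ { (here refl) → here refl }) , λ { (here refl) → refl }
  path-to {a} (step e w , a∉ ∷ u) (there d∈) with path-to (w , u) d∈
  ... | p , (wp , up) , p⊆ , b∈p⇒ =
    a ∷ p , (step e wp , All.tabulate (λ x∈p a≡x → All.lookup a∉ (p⊆ x∈p) a≡x) ∷ up) ,
    (λ { (here refl) → here refl ; (there x∈) → there (p⊆ x∈) }) ,
    λ { (here refl) → ⊥-elim (All.lookup a∉ (walk-end∈ w) refl) ; (there b∈) → b∈p⇒ b∈ }

  path-within : ∀ {a b c d L} → Path a b L → c ∈ L → d ∈ L → ∃ λ p → Path c d p × p ⊆ L
  path-within (single , _) (here refl) (here refl) = [ _ ] , (single , [] ∷ []) , λ x∈ → x∈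
  path-within P@(step _ _ , _) (here refl) d∈ with path-to P d∈
  ... | p , Pp , p⊆ , _ = p , Pp , p⊆
  path-within P@(step _ _ , _) (there c∈) (here refl) with path-to P (there c∈)
  ... | p , Pp , p⊆ , _ = reverse p , path-reverse Pp , λ x∈ → p⊆ (reverse⁻ x∈)
  path-within (step _ w , _ ∷ u) (there c∈) (there d∈) with path-within (w , u) c∈ d∈
  ... | p , Pp , p⊆ = p , Pp , λ x∈ → there (p⊆ x∈)

module TreePaths {n : ℕ} (T : Tree n) where
  open Tree T renaming (sym to adj-sym)
  open Walks adj adj-sym public

  Convex : (Fin n → Set) → Set
  Convex W = ∀ {c d p} → Path c d p → W c → W d → ∀ {x} → x ∈ p → W x

  walk-start-unique : ∀ {a a′ b b′ p} → Walk adj a b p → Walk adj a′ b′ p → a ≡ a′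
  walk-start-unique single     single         = refl
  walk-start-unique single     (step _ ())
  walk-start-unique (step _ ()) single
  walk-start-unique (step _ _) (step _ _)     = refl

  path-∷ : ∀ {z a b r} → adj z a ≡ true → z ∉ r → Path a b r → Path z b (z ∷ r)
  path-∷ e z∉ (w , u) = step e w , All.¬Any⇒All¬ _ z∉ ∷ u

  path-convex : ∀ {a b L} → Path a b L → Convex (_∈ L)
  path-convex P Q c∈ d∈ with path-within P c∈ d∈
  ... | p , Pp , p⊆ rewrite unique _ _ _ _ Q Pp = p⊆

  same-ends : ∀ {a b c d L M} → Path a b L → Path c d M → a ∈ M → b ∈ M → c ∈ L → d ∈ L →
    (c ≡ a × d ≡ b) ⊎ (c ≡ b × d ≡ a)
  same-ends (single , _) _ _ _ (here refl) (here refl) = inj₁ (refl , refl)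
  same-ends P@(step _ _ , _) Q _ b∈M (here refl) d∈ with path-to P d∈
  ... | p , Pp , _ , b∈p⇒ rewrite unique _ _ _ _ Q Pp = inj₁ (refl , b∈p⇒ b∈M)
  same-ends P@(step _ _ , _) Q _ b∈M (there c∈) (here refl) with path-to P (there c∈)
  ... | p , Pp , _ , b∈p⇒ rewrite sym (unique _ _ _ _ (path-reverse Q) Pp) =
    inj₂ (b∈p⇒ (reverse⁺ b∈M) , refl)
  same-ends (step _ w , a∉ ∷ u) Q a∈M _ (there c∈) (there d∈) with path-within (w , u) c∈ d∈
  ... | p , Pp , p⊆ rewrite unique _ _ _ _ Q Pp = ⊥-elim (All.lookup a∉ (p⊆ a∈M) refl)

  pendant-path : ∀ {a b z z′ w p L} → Path a b L → z ∉ L → z′ ∈ L → adj z z′ ≡ true →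
    Path z w p → w ∈ L → ∃ λ r → p ≡ z ∷ r × Path z′ w r × r ⊆ L
  pendant-path P z∉ z′∈ e Q w∈ with path-within P z′∈ w∈
  ... | r , Pr , r⊆ = r , unique _ _ _ _ Q (path-∷ e (z∉ ∘ r⊆) Pr) , Pr , r⊆

  pendant-convex : ∀ {a b z z′ L} → Path a b L → z ∉ L → z′ ∈ L → adj z z′ ≡ true →
    Convex (_∈ z ∷ L)
  pendant-convex {z = z} {L = L} P z∉ z′∈ e = convex
    where
    from-z : ∀ {d p} → Path z d p → d ∈ L → p ⊆ z ∷ L
    from-z Q d∈ x∈ with pendant-path P z∉ z′∈ e Q d∈
    ... | r , refl , _ , r⊆ with x∈
    ... | here refl = here refl
    ... | there x∈r = there (r⊆ x∈r)

    convex : Convex (_∈ z ∷ L)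
    convex Q (here refl) (here refl) x∈ with unique _ _ _ _ Q (single , [] ∷ [])
    convex Q (here refl) (here refl) (here refl) | refl = here refl
    convex Q (here refl) (there d∈) x∈ = from-z Q d∈ x∈
    convex Q (there c∈) (here refl) x∈ = from-z (path-reverse Q) c∈ (reverse⁺ x∈)
    convex Q (there c∈) (there d∈) x∈ = there (path-convex P Q c∈ d∈ x∈)

  module _ {c d z z′ M} (PM : Path c d M) (z∉ : z ∉ M) (z′∈ : z′ ∈ M)
           (z′≢c : z′ ≢ c) (z′≢d : z′ ≢ d) (e : adj z z′ ≡ true) where

    private
      pendant-not-path-from : ∀ {q L} → Path z q L → L ⊆ z ∷ M → z ∷ M ⊆ L → ⊥
      pendant-not-path-from (single , _) _ ⊆L with ⊆L (there z′∈)
      ... | here refl = z∉ z′∈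
      pendant-not-path-from PL@(step {w = w} {p = L′} _ wL , z∉L′ ∷ uL) L⊆ ⊆L =
        ends-differ (same-ends (wL , uL) PM (L′⊆M (walk-start∈ wL)) (L′⊆M (walk-end∈ wL))
                                (M⊆L′ (walk-start∈ (proj₁ PM))) (M⊆L′ (walk-end∈ (proj₁ PM))))
        where
        L′⊆M : L′ ⊆ M
        L′⊆M x∈ with L⊆ (there x∈)
        ... | here refl = ⊥-elim (All.lookup z∉L′ x∈ refl)
        ... | there x∈M = x∈M

        M⊆L′ : M ⊆ L′
        M⊆L′ x∈ with ⊆L (there x∈)
        ... | here refl = ⊥-elim (z∉ x∈)
        ... | there x∈L′ = x∈L′

        w≡z′ : w ≡ z′
        w≡z′ with pendant-path PM z∉ z′∈ e PL (L′⊆M (walk-end∈ wL))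
        ... | _ , refl , (wr , _) , _ = walk-start-unique wL wr

        ends-differ : ∀ {q} → (c ≡ w × d ≡ q) ⊎ (c ≡ q × d ≡ w) → ⊥
        ends-differ (inj₁ (refl , _)) = z′≢c (sym w≡z′)
        ends-differ (inj₂ (_ , refl)) = z′≢d (sym w≡z′)

    pendant-not-path : ∀ {p q L} → Path p q L → L ⊆ z ∷ M → z ∷ M ⊆ L → ⊥
    pendant-not-path {p} {q} {L} PL L⊆ ⊆L with p ≟ z | q ≟ z
    ... | yes refl | _ = pendant-not-path-from PL L⊆ ⊆L
    ... | no _ | yes refl =
      pendant-not-path-from (path-reverse PL) (L⊆ ∘ reverse⁻) (reverse⁺ ∘ ⊆L)
    ... | no p≢z | no q≢z = z∉ (path-convex PM PL (in-M p≢z (walk-start∈ (proj₁ PL)))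
                                                  (in-M q≢z (walk-end∈ (proj₁ PL)))
                                                  (⊆L (here refl)))
      where
      in-M : ∀ {x} → x ≢ z → x ∈ L → x ∈ M
      in-M x≢z x∈ with L⊆ x∈
      ... | here x≡z = ⊥-elim (x≢z x≡z)
      ... | there x∈M = x∈M

count : ∀ {k} → (Fin k → Bool) → ℕ
count {zero}  A = 0
count {suc k} A = b2n (A zero) + count (A ∘ suc)

_⊆ᵇ_ : ∀ {k} → (Fin k → Bool) → (Fin k → Bool) → Set
A ⊆ᵇ B = ∀ x → A x ≡ true → B x ≡ true

count≤ : ∀ {k} (A : Fin k → Bool) → count A ≤ k
count≤ {zero}  A = z≤n
count≤ {suc k} A with A zero
... | true  = s≤s (count≤ (A ∘ suc))
... | false = ≤-trans (count≤ (A ∘ suc)) (n≤1+n k)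

count-cong : ∀ {k} {A B : Fin k → Bool} → (∀ x → A x ≡ B x) → count A ≡ count B
count-cong {zero}  A≗B = refl
count-cong {suc k} A≗B = cong₂ _+_ (cong b2n (A≗B zero)) (count-cong (A≗B ∘ suc))

count-mono : ∀ {k} {A B : Fin k → Bool} → A ⊆ᵇ B → count A ≤ count B
count-mono {zero}  A⊆B = z≤n
count-mono {suc k} {A} {B} A⊆B with A zero in A₀ | B zero in B₀
... | true  | true  = s≤s (count-mono (A⊆B ∘ suc))
... | false | true  = ≤-trans (count-mono (A⊆B ∘ suc)) (n≤1+n _)
... | false | false = count-mono (A⊆B ∘ suc)
... | true  | false with trans (sym (A⊆B zero A₀)) B₀
... | ()

count-mono-< : ∀ {k} {A B : Fin k → Bool} → A ⊆ᵇ B → ¬ (B ⊆ᵇ A) → count A < count B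
count-mono-< {zero}  A⊆B B⊈A = ⊥-elim (B⊈A λ ())
count-mono-< {suc k} {A} {B} A⊆B B⊈A with A zero in A₀ | B zero in B₀
... | true  | true  = s≤s (count-mono-< (A⊆B ∘ suc) (B⊈A ∘ extend λ _ → A₀))
  where
  extend : (B zero ≡ true → A zero ≡ true) → (B ∘ suc) ⊆ᵇ (A ∘ suc) → B ⊆ᵇ A
  extend at-zero _ zero    = at-zero
  extend _       t (suc x) = t x
... | false | true  = s≤s (count-mono (A⊆B ∘ suc))
... | false | false = count-mono-< (A⊆B ∘ suc) (B⊈A ∘ extend)
  where
  extend : (B ∘ suc) ⊆ᵇ (A ∘ suc) → B ⊆ᵇ A
  extend _ zero B₀≡true with trans (sym B₀) B₀≡true
  ... | ()
  extend t (suc x) = t x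
... | true  | false with trans (sym (A⊆B zero A₀)) B₀
... | ()

count-insert : ∀ {k} {A B : Fin k → Bool} z → A z ≡ false → B z ≡ true →
  (∀ x → x ≢ z → A x ≡ B x) → count B ≡ suc (count A)
count-insert {suc k} zero A₀ B₀ A≗B rewrite A₀ | B₀ =
  cong suc (sym (count-cong λ x → A≗B (suc x) λ ()))
count-insert {suc k} {A} {B} (suc z) Az Bz A≗B rewrite A≗B zero (λ ()) =
  trans (cong (b2n (B zero) +_) (count-insert z Az Bz λ x x≢z → A≗B (suc x) (x≢z ∘ suc-injective)))
        (+-suc _ _)

module _ {n : ℕ} where
  open import Data.List.Membership.DecPropositional (_≟_ {n = n}) using (_∈?_)

  _∈ᵇ_ : Fin n → List (Fin n) → Bool
  x ∈ᵇ L = does (x ∈? L)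

  ∈⇒∈ᵇ : ∀ {x L} → x ∈ L → x ∈ᵇ L ≡ true
  ∈⇒∈ᵇ {x} {L} = dec-true (x ∈? L)

  ∉⇒∈ᵇ : ∀ {x L} → x ∉ L → x ∈ᵇ L ≡ false
  ∉⇒∈ᵇ {x} {L} = dec-false (x ∈? L)

  ∈ᵇ⇒∈ : ∀ {x L} → x ∈ᵇ L ≡ true → x ∈ L
  ∈ᵇ⇒∈ {x} {L} x∈ᵇL with x ∈? L | x∈ᵇL
  ... | yes x∈L | _ = x∈L
  ... | no _    | ()

  ∈ᵇ⇒∉ : ∀ {x L} → x ∈ᵇ L ≡ false → x ∉ L
  ∈ᵇ⇒∉ x∉ᵇL x∈L with trans (sym (∈⇒∈ᵇ x∈L)) x∉ᵇL
  ... | ()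

  size : List (Fin n) → ℕ
  size L = count (_∈ᵇ L)

  size≤ : ∀ L → size L ≤ n
  size≤ L = count≤ (_∈ᵇ L)

  size-mono : ∀ {xs ys} → xs ⊆ ys → size xs ≤ size ys
  size-mono {xs} {ys} xs⊆ys = count-mono {A = _∈ᵇ xs} {B = _∈ᵇ ys} (λ _ → ∈⇒∈ᵇ ∘ xs⊆ys ∘ ∈ᵇ⇒∈)

  size-mono-< : ∀ {xs ys} → xs ⊆ ys → ¬ (ys ⊆ xs) → size xs < size ys
  size-mono-< {xs} {ys} xs⊆ys ys⊈xs =
    count-mono-< {A = _∈ᵇ xs} {B = _∈ᵇ ys} (λ _ → ∈⇒∈ᵇ ∘ xs⊆ys ∘ ∈ᵇ⇒∈)
                 (λ ys⊆ᵇxs → ys⊈xs (∈ᵇ⇒∈ ∘ ys⊆ᵇxs _ ∘ ∈⇒∈ᵇ))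

  size-∷ : ∀ {z xs} → z ∉ xs → size (z ∷ xs) ≡ suc (size xs)
  size-∷ {z} {xs} z∉ =
    count-insert {A = _∈ᵇ xs} {B = _∈ᵇ (z ∷ xs)} z (∉⇒∈ᵇ z∉) (∈⇒∈ᵇ {z} {z ∷ xs} (here refl)) same
    where
    same : ∀ x → x ≢ z → x ∈ᵇ xs ≡ x ∈ᵇ (z ∷ xs)
    same x x≢z rewrite dec-false (x ≟ z) x≢z = refl

module _ {n : ℕ} where

  does-≟-sym : (c d : Fin n) → does (c ≟ d) ≡ does (d ≟ c)
  does-≟-sym c d with c ≟ d | d ≟ c
  ... | yes _    | yes _    = refl
  ... | no _     | no _     = refl
  ... | yes refl | no d≢c   = ⊥-elim (d≢c refl)
  ... | no c≢d   | yes refl = ⊥-elim (c≢d refl)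

  -- The multicut whose only non-singleton component is W: x c d = 1 iff c ≠ d and not both lie in W.
  clusterCut : (Fin n → Bool) → Point n
  clusterCut W c d = not (W c ∧ W d ∨ does (c ≟ d))

  module _ (W : Fin n → Bool) where

    clusterCut-sym : ∀ c d → clusterCut W c d ≡ clusterCut W d c
    clusterCut-sym c d = cong not (cong₂ _∨_ (∧-comm (W c) (W d)) (does-≟-sym c d))

    clusterCut-diag : ∀ c → clusterCut W c c ≡ false
    clusterCut-diag c = cong not (trans (cong (W c ∧ W c ∨_) (dec-true (c ≟ c) refl)) (∨-zeroʳ _))

    clusterCut-≢ : ∀ {c d} → c ≢ d → clusterCut W c d ≡ not (W c ∧ W d)
    clusterCut-≢ {c} {d} c≢d =
      cong not (trans (cong (W c ∧ W d ∨_) (dec-false (c ≟ d) c≢d)) (∨-identityʳ _))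

    clusterCut-inside : ∀ {c d} → W c ≡ true → W d ≡ true → clusterCut W c d ≡ false
    clusterCut-inside Wc Wd rewrite Wc | Wd = refl

    clusterCut-outside : ∀ {c d} → c ≢ d → W c ≡ false ⊎ W d ≡ false → clusterCut W c d ≡ true
    clusterCut-outside {c} {d} c≢d W≡false rewrite clusterCut-≢ c≢d with W≡false
    ... | inj₁ Wc rewrite Wc = refl
    ... | inj₂ Wd rewrite Wd | ∧-comm (W c) false = refl

module _ {n : ℕ} (T : Tree n) where
  open TreePaths T

  clusterCut-∈X : ∀ {W} → Convex (λ x → W x ≡ true) → InX T (clusterCut W)
  clusterCut-∈X {W} convex = clusterCut-sym W , clusterCut-diag W , lifted-constraints
    where
    cost : Fin n × Fin n → ℕ
    cost (a , b) = b2n (clusterCut W a b)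

    lifted-constraints : ∀ u v p → Path u v p → 2 ≤ nEdges p →
        b2n (clusterCut W u v) ≤ sum (map cost (edgesOf p))
      × All (λ e → cost e ≤ b2n (clusterCut W u v)) (edgesOf p)
    lifted-constraints u v p (step _ single , _) (s≤s ())
    lifted-constraints u v p P@(step _ w@(step _ _) , u∉ ∷ U) _ = upper , All.tabulate edge≤
      where
      u≢v : u ≢ v
      u≢v refl = All.lookup u∉ (walk-end∈ w) refl

      cut-edge : ∀ {c d} → (c , d) ∈ edgesOf p → W c ≡ false ⊎ W d ≡ false →
        1 ≤ sum (map cost (edgesOf p))
      cut-edge e∈ W≡false = ≤-trans
        (b2n-true (clusterCut-outside W (edgesOf-Unique⇒≢ (proj₂ P) e∈) W≡false)) (≤-sum-map cost e∈)

      cut-at : ∀ {y} → y ∈ p → W y ≡ false → 1 ≤ sum (map cost (edgesOf p))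
      cut-at y∈ Wy with incident-edge y∈
      ... | _ , inj₁ e∈ = cut-edge e∈ (inj₁ Wy)
      ... | _ , inj₂ e∈ = cut-edge e∈ (inj₂ Wy)

      upper : b2n (clusterCut W u v) ≤ sum (map cost (edgesOf p))
      upper = by-cases _ _ refl refl
        where
        by-cases : ∀ bu bv → W u ≡ bu → W v ≡ bv →
          b2n (clusterCut W u v) ≤ sum (map cost (edgesOf p))
        by-cases true  true  Wu Wv rewrite clusterCut-inside W Wu Wv = z≤n
        by-cases false _     Wu _  = ≤-trans (b2n≤1 _) (cut-at (here refl) Wu)
        by-cases true  false _  Wv = ≤-trans (b2n≤1 _) (cut-at (walk-end∈ (proj₁ P)) Wv)

      edge≤ : ∀ {e} → e ∈ edgesOf p → cost e ≤ b2n (clusterCut W u v)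
      edge≤ {a , b} e∈ = by-cases _ _ refl refl
        where
        by-cases : ∀ bu bv → W u ≡ bu → W v ≡ bv → cost (a , b) ≤ b2n (clusterCut W u v)
        by-cases true true Wu Wv with ∈-edgesOf⇒∈ e∈
        ... | a∈ , b∈ rewrite clusterCut-inside W (convex P Wu Wv a∈) (convex P Wu Wv b∈) = z≤n
        by-cases false _     Wu _  rewrite clusterCut-outside W u≢v (inj₁ Wu) = b2n≤1 _
        by-cases true  false _  Wv rewrite clusterCut-outside W u≢v (inj₂ Wv) = b2n≤1 _

  Convex-∈ᵇ : ∀ {L} → Convex (_∈ L) → Convex (λ x → x ∈ᵇ L ≡ true)
  Convex-∈ᵇ convex P c∈ d∈ x∈ = ∈⇒∈ᵇ (convex P (∈ᵇ⇒∈ c∈) (∈ᵇ⇒∈ d∈) x∈)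

  listCut-∈X : ∀ {L} → Convex (_∈ L) → InX T (clusterCut (_∈ᵇ L))
  listCut-∈X = clusterCut-∈X ∘ Convex-∈ᵇ

module _ {n : ℕ} (T : Tree n) {x : Point n} (x∈X : InX T x) where
  open TreePaths T

  cut-on-path : ∀ {a b p} → Path a b p → a ≢ b → x a b ≡ true →
    ∃₂ λ c d → (c , d) ∈ edgesOf p × x c d ≡ true
  cut-on-path (single , _) a≢b _ = ⊥-elim (a≢b refl)
  cut-on-path (step _ single , _) _ xab = _ , _ , here refl , xab
  cut-on-path {a} {b} P@(step _ (step _ w) , _) _ xab
    with sum-pos {A = Fin n × Fin n} _ _
           (≤-trans (b2n-true xab) (proj₁ (proj₂ (proj₂ x∈X) a b _ P (s≤s (walk-length w)))))
  ... | (c , d) , e∈ , 1≤ = c , d , e∈ , b2n-pos 1≤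

  cut-spreads : ∀ {a b c d p} → Path a b p → (c , d) ∈ edgesOf p → x c d ≡ true → x a b ≡ true
  cut-spreads (step _ single , _) (here refl) xcd = xcd
  cut-spreads {a} {b} P@(step _ (step _ w) , _) e∈ xcd =
    b2n-pos (≤-trans (b2n-true xcd)
                     (All.lookup (proj₂ (proj₂ (proj₂ x∈X) a b _ P (s≤s (walk-length w)))) e∈))

sumℚ≡sum : ∀ k (f : Fin k → ℚ) → sumℚ k f ≡ ℚSum.sum f
sumℚ≡sum zero    f = refl
sumℚ≡sum (suc k) f = cong (f zero +ℚ_) (sumℚ≡sum k (f ∘ suc))

sumℚ-cong : ∀ k {f g : Fin k → ℚ} → (∀ i → f i ≡ g i) → sumℚ k f ≡ sumℚ k g
sumℚ-cong k {f} {g} f≗g =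
  trans (sumℚ≡sum k f) (trans (ℚSum.sum-cong-≗ f≗g) (sym (sumℚ≡sum k g)))

sumℚ-+ : ∀ k (f g : Fin k → ℚ) → sumℚ k (λ i → f i +ℚ g i) ≡ sumℚ k f +ℚ sumℚ k g
sumℚ-+ k f g rewrite sumℚ≡sum k (λ i → f i +ℚ g i) | sumℚ≡sum k f | sumℚ≡sum k g =
  ℚSum.∑-distrib-+ f g

sumℚ-supported : ∀ k (f : Fin k → ℚ) i → (∀ j → j ≢ i → f j ≡ 0ℚ) → sumℚ k f ≡ f i
sumℚ-supported (suc k) f i f≡0 = begin
  sumℚ (suc k) f                    ≡⟨ sumℚ≡sum (suc k) f ⟩
  ℚSum.sum f                        ≡⟨ ℚSum.sum-remove f ⟩
  f i +ℚ ℚSum.sum (removeAt f i)    ≡⟨ cong (f i +ℚ_) (ℚSum.sum-cong-≗ λ j → f≡0 _ (punchInᵢ≢i i j)) ⟩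
  f i +ℚ ℚSum.sum (replicate k 0ℚ)  ≡⟨ cong (f i +ℚ_) (ℚSum.sum-replicate-zero k) ⟩
  f i +ℚ 0ℚ                         ≡⟨ +-identityʳ (f i) ⟩
  f i                               ∎
  where open ≡-Reasoning

module _ {k : ℕ} (J : Fin k → Fin k → Bool) (rank : Fin k → ℕ) (bound : ℕ)
         (rank≤ : ∀ i → rank i ≤ bound)
         (J-diag : ∀ {i j} → J j i ≡ true → J j j ≡ true)
         (J-upper : ∀ {i j} → j ≢ i → J i i ≡ true → J j i ≡ true → rank i < rank j) where

  triangular-kernel : (c : Fin k → ℚ) → (∀ i → sumℚ k (λ j → c j * b2q (J j i)) ≡ 0ℚ) →
    ∀ i → J i i ≡ true → c i ≡ 0ℚ
  triangular-kernel c Σ≡0 i = go (suc bound) i (m≤n+m (suc bound) (rank i))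
    where
    -- Downward induction on rank i: the fuel exceeds bound ∸ rank i.
    go : ∀ fuel i → bound < rank i + fuel → J i i ≡ true → c i ≡ 0ℚ
    go zero i b< _ = ⊥-elim (<⇒≱ (subst (bound <_) (ℕ.+-identityʳ (rank i)) b<) (rank≤ i))
    go (suc fuel) i b< Jii = begin
      c i                               ≡⟨ sym (*-identityʳ (c i)) ⟩
      c i * b2q true                    ≡⟨ cong (λ b → c i * b2q b) (sym Jii) ⟩
      c i * b2q (J i i)                 ≡⟨ sym (sumℚ-supported k _ i others-vanish) ⟩
      sumℚ k (λ j → c j * b2q (J j i))  ≡⟨ Σ≡0 i ⟩
      0ℚ                                ∎
      where
      open ≡-Reasoning
      fuel-ok : ∀ {j} → rank i < rank j → bound < rank j + fuel
      fuel-ok {j} ri<rj =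
        <-≤-trans b< (subst (_≤ rank j + fuel) (sym (+-suc (rank i) fuel)) (+-monoˡ-≤ fuel ri<rj))

      others-vanish : ∀ j → j ≢ i → c j * b2q (J j i) ≡ 0ℚ
      others-vanish j j≢i with J j i in Jji
      ... | false = *-zeroʳ (c j)
      ... | true rewrite go fuel j (fuel-ok (J-upper j≢i Jii Jji)) (J-diag Jji) = *-zeroˡ 1ℚ

b2q-split : ∀ c b → c ≡ c * b2q (not b) +ℚ c * b2q b
b2q-split c true  = sym (trans (cong (_+ℚ c * 1ℚ) (*-zeroʳ c)) (trans (+-identityˡ _) (*-identityʳ c)))
b2q-split c false = sym (trans (cong (c * 1ℚ +ℚ_) (*-zeroʳ c)) (trans (+-identityʳ _) (*-identityʳ c)))

sumℚ-complement : ∀ k (c : Fin k → ℚ) (y : Fin k → Bool) → sumℚ k c ≡ 0ℚ →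
  sumℚ k (λ j → c j * b2q (y j)) ≡ 0ℚ → sumℚ k (λ j → c j * b2q (not (y j))) ≡ 0ℚ
sumℚ-complement k c y Σc≡0 Σcy≡0 = begin
  Σc¬y                                    ≡⟨ sym (+-identityʳ Σc¬y) ⟩
  Σc¬y +ℚ 0ℚ                              ≡⟨ cong (Σc¬y +ℚ_) (sym Σcy≡0) ⟩
  Σc¬y +ℚ sumℚ k (λ j → c j * b2q (y j))  ≡⟨ sym (sumℚ-+ k _ _) ⟩
  sumℚ k (λ j → c j * b2q (not (y j)) +ℚ c j * b2q (y j))
                                          ≡⟨ sym (sumℚ-cong k λ j → b2q-split (c j) (y j)) ⟩
  sumℚ k c                                ≡⟨ Σc≡0 ⟩
  0ℚ                                      ∎
  where
  open ≡-Reasoning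
  Σc¬y : ℚ
  Σc¬y = sumℚ k (λ j → c j * b2q (not (y j)))

module _ {n k : ℕ} (p : Fin k → Point n) (a b : Fin k → Fin n) where

  joins : Fin k → Fin k → Bool
  joins j i = not (p j (a i) (b i))

  triangular⇒affinelyIndependent : (∀ i → a i ≢ b i) →
    (rank : Fin k → ℕ) (bound : ℕ) → (∀ i → rank i ≤ bound) →
    (∀ {i j} → joins j i ≡ true → joins j j ≡ true) →
    (∀ {i j} → j ≢ i → joins i i ≡ true → joins j i ≡ true → rank i < rank j) →
    (∀ {i j} → joins i i ≡ false → joins j j ≡ false → i ≡ j) →
    AffinelyIndependent k p
  triangular⇒affinelyIndependent a≢b rank bound rank≤ diag upper unjoined-unique c Σc≡0 Σcp≡0 = vanish
    where
    on-diagonal : ∀ i → joins i i ≡ true → c i ≡ 0ℚ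
    on-diagonal = triangular-kernel joins rank bound rank≤ diag upper c
      λ i → sumℚ-complement k c (λ j → p j (a i) (b i)) Σc≡0 (Σcp≡0 (a i) (b i) (a≢b i))

    vanish : ∀ i → c i ≡ 0ℚ
    vanish i with joins i i in Jii
    ... | true  = on-diagonal i Jii
    ... | false = trans (sym (sumℚ-supported k c i others-vanish)) Σc≡0
      where
      others-vanish : ∀ j → j ≢ i → c j ≡ 0ℚ
      others-vanish j j≢i with joins j j in Jjj
      ... | true  = on-diagonal j Jjj
      ... | false = ⊥-elim (j≢i (unjoined-unique Jjj Jii))

choose2 : ℕ → ℕ
choose2 zero    = 0
choose2 (suc n) = n + choose2 n

choose2≡C2 : ∀ n → choose2 n ≡ n C 2
choose2≡C2 zero    = refl
choose2≡C2 (suc n) =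
  trans (cong₂ _+_ (sym (nC1≡n n)) (choose2≡C2 n)) (nCk+nC[k+1]≡[n+1]C[k+1] n 1)

-- The pairs a < b of Fin (suc n): first (a , n) for all a < n, then the pairs of Fin n.
pairAt : ∀ n → Fin (choose2 n) → Fin n × Fin n
pairAt (suc n) i with splitAt n i
... | inj₁ a = inject₁ a , fromℕ n
... | inj₂ r = Product.map inject₁ inject₁ (pairAt n r)

pairAt-< : ∀ n i → toℕ (proj₁ (pairAt n i)) < toℕ (proj₂ (pairAt n i))
pairAt-< (suc n) i with splitAt n i
... | inj₁ a rewrite toℕ-inject₁ a | toℕ-fromℕ n = toℕ<n a
... | inj₂ r rewrite toℕ-inject₁ (proj₁ (pairAt n r)) | toℕ-inject₁ (proj₂ (pairAt n r)) =
  pairAt-< n r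

splitAt-injective : ∀ m {n} {i j : Fin (m + n)} → splitAt m i ≡ splitAt m j → i ≡ j
splitAt-injective m {n} {i} {j} eq =
  trans (sym (join-splitAt m n i)) (trans (cong (join m n) eq) (join-splitAt m n j))

pairAt-injective : ∀ n {i j} → pairAt n i ≡ pairAt n j → i ≡ j
pairAt-injective (suc n) {i} {j} eq with splitAt n i in si | splitAt n j in sj
... | inj₁ a | inj₁ a′ =
  splitAt-injective n (trans si (trans (cong inj₁ (inject₁-injective (cong proj₁ eq))) (sym sj)))
... | inj₁ _ | inj₂ _ = ⊥-elim (fromℕ≢inject₁ (cong proj₂ eq))
... | inj₂ _ | inj₁ _ = ⊥-elim (fromℕ≢inject₁ (sym (cong proj₂ eq)))
... | inj₂ r | inj₂ r′ =
  splitAt-injective n (trans si (trans (cong inj₂ (pairAt-injective n (cong₂ _,_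
    (inject₁-injective (cong proj₁ eq)) (inject₁-injective (cong proj₂ eq))))) (sym sj)))

pair : ∀ n → Fin (n C 2) → Fin n × Fin n
pair n i = pairAt n (cast (sym (choose2≡C2 n)) i)

pair-< : ∀ n i → toℕ (proj₁ (pair n i)) < toℕ (proj₂ (pair n i))
pair-< n i = pairAt-< n _

pair-injective : ∀ n {i j} → pair n i ≡ pair n j → i ≡ j
pair-injective n {i} {j} eq =
  trans (sym (cast-involutive (choose2≡C2 n) (sym (choose2≡C2 n)) i))
        (trans (cong (cast (choose2≡C2 n)) (pairAt-injective n eq))
               (cast-involutive (choose2≡C2 n) (sym (choose2≡C2 n)) j))

ordered-pair-unique : ∀ {n} {a b a′ b′ : Fin n} → toℕ a < toℕ b → toℕ a′ < toℕ b′ →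
  (a′ ≡ a × b′ ≡ b) ⊎ (a′ ≡ b × b′ ≡ a) → (a , b) ≡ (a′ , b′)
ordered-pair-unique _   _    (inj₁ (refl , refl)) = refl
ordered-pair-unique a<b a′<b′ (inj₂ (refl , refl)) = ⊥-elim (<-asym a<b a′<b′)

-- A, B, C, D say whether u, u′, v′, v (in this order along a path) lie in a convex set; the first
-- three hypotheses come from convexity, the last one excludes the set {u′, v′} itself.
interval-identity : ∀ A B C D →
  (A ≡ true → C ≡ true → B ≡ true) → (A ≡ true → D ≡ true → B ≡ true) →
  (B ≡ true → D ≡ true → C ≡ true) → ¬ (A ≡ false × B ≡ true × C ≡ true × D ≡ false) →
  b2n (not (A ∧ D)) + b2n (not (B ∧ C)) ≡ b2n (not (A ∧ C)) + b2n (not (B ∧ D))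
interval-identity true  true  true  true  _ _ _ _ = refl
interval-identity true  true  true  false _ _ _ _ = refl
interval-identity true  true  false true  _ _ _ _ = refl
interval-identity true  true  false false _ _ _ _ = refl
interval-identity true  false true  true  _ _ _ _ = refl
interval-identity true  false true  false ac⇒b _ _ _ with ac⇒b refl refl
... | ()
interval-identity true  false false true  _ ad⇒b _ _ with ad⇒b refl refl
... | ()
interval-identity true  false false false _ _ _ _ = refl
interval-identity false true  true  true  _ _ _ _ = refl
interval-identity false true  true  false _ _ _ not-inner = ⊥-elim (not-inner (refl , refl , refl , refl))
interval-identity false true  false true  _ _ bd⇒c _ with bd⇒c refl refl
... | ()
interval-identity false true  false false _ _ _ _ = refl
interval-identity false false true  true  _ _ _ _ = refl
interval-identity false false true  false _ _ _ _ = refl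
interval-identity false false false true  _ _ _ _ = refl
interval-identity false false false false _ _ _ _ = refl

module Facet {n : ℕ} (T : Tree n) (u u′ v′ v : Fin n) (q : List (Fin n))
             (P0 : IsPath (Tree.adj T) u v (u ∷ u′ ∷ (q ++ (v′ ∷ [ v ])))) where
  open Tree T using (adj; connected) renaming (sym to adj-sym)
  open TreePaths T

  lhs rhs : Point n → ℕ
  lhs x = b2n (x u v) + b2n (x u′ v′)
  rhs x = b2n (x u v′) + b2n (x u′ v)

  inner : List (Fin n)
  inner = u′ ∷ q ++ [ v′ ]

  u→v′ : Path u v′ (u ∷ inner)
  u→v′ = path-prefix (u ∷ u′ ∷ q) P0

  u′→v : Path u′ v (u′ ∷ q ++ v′ ∷ [ v ])
  u′→v = path-suffix [ u ] P0

  u′→v′ : Path u′ v′ inner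
  u′→v′ = path-prefix (u′ ∷ q) u′→v

  v′∈inner : v′ ∈ inner
  v′∈inner = walk-end∈ (proj₁ u′→v′)

  u∉inner : u ∉ inner
  u∉inner = Unique[x∷xs]⇒x∉xs (proj₂ u→v′)

  v∉inner : v ∉ inner
  v∉inner = Unique-last∉ (u′ ∷ q) (proj₂ u′→v)

  u≢v : u ≢ v
  u≢v = ∉-∈⇒≢ (Unique[x∷xs]⇒x∉xs (proj₂ P0)) (walk-end∈ (proj₁ u′→v))

  u≢v′ : u ≢ v′
  u≢v′ = ∉-∈⇒≢ u∉inner v′∈inner

  u′≢v : u′ ≢ v
  u′≢v = ≢-sym (∉-∈⇒≢ v∉inner (here refl))

  u′≢v′ : u′ ≢ v′
  u′≢v′ = ∉-∈⇒≢ (Unique[x∷xs]⇒x∉xs (proj₂ u′→v′)) (∈-++⁺ʳ q (here refl))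

  adj-uu′ : adj u u′ ≡ true
  adj-uu′ = walk-head-adj (proj₁ P0)

  adj-vv′ : adj v v′ ≡ true
  adj-vv′ = trans (adj-sym v v′) (walk-head-adj (proj₁ (path-suffix (u ∷ u′ ∷ q) P0)))

  valid : ∀ x → InX T x → lhs x ≤ rhs x
  valid x x∈X with x u′ v′ in cut-inner
  ... | true with cut-on-path T x∈X u′→v′ u′≢v′ cut-inner
  ...   | _ , _ , e∈ , cut-e
    rewrite cut-spreads T x∈X u→v′ (there e∈) cut-e
          | cut-spreads T x∈X u′→v (edgesOf-prefix (u′ ∷ q) e∈) cut-e =
    +-monoˡ-≤ 1 (b2n≤1 (x u v))
  valid x x∈X | false with x u v in cut-uv
  ... | false = z≤n
  ... | true with cut-on-path T x∈X P0 u≢v cut-uv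
  ...   | _ , _ , here refl , cut-e rewrite cut-spreads T x∈X u→v′ (here refl) cut-e = s≤s z≤n
  ...   | _ , _ , there e∈ , cut-e rewrite cut-spreads T x∈X u′→v e∈ cut-e = m≤n+m 1 _

  InnerPair : Fin n → Fin n → Set
  InnerPair a b = (a ≡ u′ × b ≡ v′) ⊎ (a ≡ v′ × b ≡ u′)

  Untight : List (Fin n) → Set
  Untight L = u′ ∈ L × v′ ∈ L × u ∉ L × v ∉ L

  convex-tight : ∀ {L} → Convex (_∈ L) → ¬ Untight L →
    lhs (clusterCut (_∈ᵇ L)) ≡ rhs (clusterCut (_∈ᵇ L))
  convex-tight {L} convex tight-L
    rewrite clusterCut-≢ (_∈ᵇ L) u≢v | clusterCut-≢ (_∈ᵇ L) u′≢v′
          | clusterCut-≢ (_∈ᵇ L) u≢v′ | clusterCut-≢ (_∈ᵇ L) u′≢v =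
    interval-identity (u ∈ᵇ L) (u′ ∈ᵇ L) (v′ ∈ᵇ L) (v ∈ᵇ L)
      (λ u∈ v′∈ → convexᵇ u→v′ u∈ v′∈ (there (here refl)))
      (λ u∈ v∈ → convexᵇ P0 u∈ v∈ (there (here refl)))
      (λ u′∈ v∈ → convexᵇ u′→v u′∈ v∈ (there (∈-++⁺ʳ q (here refl))))
      λ (u∉ , u′∈ , v′∈ , v∉) → tight-L (∈ᵇ⇒∈ u′∈ , ∈ᵇ⇒∈ v′∈ , ∈ᵇ⇒∉ u∉ , ∈ᵇ⇒∉ v∉)
    where
    convexᵇ : Convex (λ x → x ∈ᵇ L ≡ true)
    convexᵇ = Convex-∈ᵇ T convex

  innerCut : Point n
  innerCut = clusterCut (_∈ᵇ inner)

  innerCut-∈X : InX T innerCut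
  innerCut-∈X = listCut-∈X T (path-convex u′→v′)

  innerCut-untight : lhs innerCut ≢ rhs innerCut
  innerCut-untight
    rewrite clusterCut-outside (_∈ᵇ inner) u≢v (inj₁ (∉⇒∈ᵇ u∉inner))
          | clusterCut-inside (_∈ᵇ inner) (∈⇒∈ᵇ {x = u′} {L = inner} (here refl))
                                          (∈⇒∈ᵇ v′∈inner)
          | clusterCut-outside (_∈ᵇ inner) u≢v′ (inj₁ (∉⇒∈ᵇ u∉inner))
          | clusterCut-outside (_∈ᵇ inner) u′≢v (inj₂ (∉⇒∈ᵇ v∉inner)) = λ ()

  route : Fin n → Fin n → List (Fin n)
  route a b = proj₁ (connected a b)

  route-path : ∀ a b → Path a b (route a b)
  route-path a b = proj₂ (connected a b)

  route-start∈ : ∀ a b → a ∈ route a b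
  route-start∈ a b = walk-start∈ (proj₁ (route-path a b))

  route-end∈ : ∀ a b → b ∈ route a b
  route-end∈ a b = walk-end∈ (proj₁ (route-path a b))

  untight? : ∀ L → Dec (Untight L)
  untight? L = u′ ∈? L ×-dec v′ ∈? L ×-dec ¬? (u ∈? L) ×-dec ¬? (v ∈? L)
    where open import Data.List.Membership.DecPropositional (_≟_ {n = n}) using (_∈?_)

  Pendant : Fin n → Fin n → Set
  Pendant z z′ = (z ≡ u × z′ ≡ u′) ⊎ (z ≡ v × z′ ≡ v′)

  pendant-adj : ∀ {z z′} → Pendant z z′ → adj z z′ ≡ true
  pendant-adj (inj₁ (refl , refl)) = adj-uu′
  pendant-adj (inj₂ (refl , refl)) = adj-vv′

  pendant-∉ : ∀ {z z′ L} → Untight L → Pendant z z′ → z ∉ L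
  pendant-∉ (_ , _ , u∉ , _) (inj₁ (refl , _)) = u∉
  pendant-∉ (_ , _ , _ , v∉) (inj₂ (refl , _)) = v∉

  anchor-∈ : ∀ {z z′ L} → Untight L → Pendant z z′ → z′ ∈ L
  anchor-∈ (u′∈ , _ , _ , _) (inj₁ (_ , refl)) = u′∈
  anchor-∈ (_ , v′∈ , _ , _) (inj₂ (_ , refl)) = v′∈

  -- A route through u′ and v′ avoiding u and v would not give a tight point; it is extended by u
  -- (next to u′) or v (next to v′), whichever is attached to an inner node of the route.
  data Choice (a b : Fin n) : Set where
    singletons : InnerPair a b → Choice a b
    route-only : ¬ Untight (route a b) → Choice a b
    pendant    : Untight (route a b) → ∀ z {z′} → Pendant z z′ → z′ ≢ a → z′ ≢ b → Choice a b

  choose : ∀ a b → Choice a b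
  choose a b with (a ≟ u′ ×-dec b ≟ v′) ⊎-dec (a ≟ v′ ×-dec b ≟ u′)
  ... | yes ends = singletons ends
  ... | no not-ends with untight? (route a b)
  ...   | no tight-route = route-only tight-route
  ...   | yes untight with u′ ≟ a | u′ ≟ b
  ...     | no u′≢a | no u′≢b = pendant untight u (inj₁ (refl , refl)) u′≢a u′≢b
  ...     | yes refl | _ =
    pendant untight v (inj₂ (refl , refl)) (≢-sym u′≢v′) λ v′≡b → not-ends (inj₁ (refl , sym v′≡b))
  ...     | no _ | yes refl =
    pendant untight v (inj₂ (refl , refl)) (λ v′≡a → not-ends (inj₂ (sym v′≡a , refl))) (≢-sym u′≢v′)

  cluster : ∀ {a b} → Choice a b → List (Fin n)
  cluster         (singletons _)       = []
  cluster {a} {b} (route-only _)       = route a b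
  cluster {a} {b} (pendant _ z _ _ _)  = z ∷ route a b

  cluster-convex : ∀ {a b} (k : Choice a b) → Convex (_∈ cluster k)
  cluster-convex         (singletons _) _ () _ _
  cluster-convex {a} {b} (route-only _) = path-convex (route-path a b)
  cluster-convex {a} {b} (pendant untight _ zz′ _ _) =
    pendant-convex (route-path a b) (pendant-∉ untight zz′) (anchor-∈ untight zz′) (pendant-adj zz′)

  cluster-tight : ∀ {a b} (k : Choice a b) → ¬ Untight (cluster k)
  cluster-tight (singletons _)                             (() , _)
  cluster-tight (route-only tight-route)                   = tight-route
  cluster-tight (pendant _ _ (inj₁ (refl , _)) _ _) (_ , _ , u∉ , _) = u∉ (here refl)
  cluster-tight (pendant _ _ (inj₂ (refl , _)) _ _) (_ , _ , _ , v∉) = v∉ (here refl)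

  cluster-ends : ∀ {a b x} (k : Choice a b) → x ∈ cluster k → a ∈ cluster k × b ∈ cluster k
  cluster-ends         (singletons _)      ()
  cluster-ends {a} {b} (route-only _)      _ =
    route-start∈ a b , route-end∈ a b
  cluster-ends {a} {b} (pendant _ _ _ _ _) _ =
    there (route-start∈ a b) , there (route-end∈ a b)

  empty-cluster : ∀ {a b} (k : Choice a b) → a ∉ cluster k → InnerPair a b
  empty-cluster (singletons ends) _ = ends
  empty-cluster k@(route-only _)      a∉ = ⊥-elim (a∉ (proj₁ (cluster-ends k (route-start∈ _ _))))
  empty-cluster k@(pendant _ _ _ _ _) a∉ = ⊥-elim (a∉ (proj₁ (cluster-ends k (here refl))))

  size-route+cluster-< : ∀ {a b a′ b′} (k : Choice a b) (k′ : Choice a′ b′) → a ∈ cluster k →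
    route a b ⊆ cluster k′ → (route a′ b′ ⊆ route a b → route a b ⊆ route a′ b′ → ⊥) →
    size (route a b) + size (cluster k) < size (route a′ b′) + size (cluster k′)
  size-route+cluster-< (singletons _) _ () _ _
  size-route+cluster-< {a} {b} _ (singletons _) _ R⊆ _ with R⊆ (route-start∈ a b)
  ... | ()
  size-route+cluster-< {a} {b} {a′} {b′} (route-only _) (route-only _) _ R⊆R′ distinct =
    +-mono-< R<R′ R<R′
    where
    R<R′ : size (route a b) < size (route a′ b′)
    R<R′ = size-mono-< R⊆R′ (λ R′⊆R → distinct R′⊆R R⊆R′)
  size-route+cluster-< {a} {b} {a′} {b′}
    (route-only _) (pendant untight′ z zz′ z′≢a′ z′≢b′) _ R⊆C′ _ =
    +-mono-≤-< (s≤s⁻¹ (subst (_ <_) (size-∷ z∉R′) R<C′)) R<C′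
    where
    z∉R′ : z ∉ route a′ b′
    z∉R′ = pendant-∉ untight′ zz′
    R<C′ : size (route a b) < size (z ∷ route a′ b′)
    R<C′ = size-mono-< R⊆C′ λ C′⊆R →
      pendant-not-path (route-path a′ b′) z∉R′ (anchor-∈ untight′ zz′) z′≢a′ z′≢b′ (pendant-adj zz′)
                       (route-path a b) R⊆C′ C′⊆R
  size-route+cluster-< {a} {b} {a′} {b′} (pendant untight z zz′ _ _) (route-only _) _ R⊆R′ distinct =
    +-mono-<-≤ R<R′ (subst (_≤ _) (sym (size-∷ (pendant-∉ untight zz′))) R<R′)
    where
    R<R′ : size (route a b) < size (route a′ b′)
    R<R′ = size-mono-< R⊆R′ (λ R′⊆R → distinct R′⊆R R⊆R′)
  size-route+cluster-< {a} {b} {a′} {b′}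
    (pendant untight z zz′ _ _) (pendant untight′ z′ zz′′ _ _) _ R⊆C′ distinct
    rewrite size-∷ (pendant-∉ untight zz′) | size-∷ (pendant-∉ untight′ zz′′) = +-mono-< R<R′ (s≤s R<R′)
    where
    R⊆R′ : route a b ⊆ route a′ b′
    R⊆R′ = ⊆-∷⁻ R⊆C′ (pendant-∉ untight zz′′)
    R<R′ : size (route a b) < size (route a′ b′)
    R<R′ = size-mono-< R⊆R′ (λ R′⊆R → distinct R′⊆R R⊆R′)

  m : ℕ
  m = n C 2

  end₁ end₂ : Fin m → Fin n
  end₁ i = proj₁ (pair n i)
  end₂ i = proj₂ (pair n i)

  end₁≢end₂ : ∀ i → end₁ i ≢ end₂ i
  end₁≢end₂ i ends≡ = <-irrefl (cong toℕ ends≡) (pair-< n i)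

  same-pair : ∀ {i j} →
    (end₁ j ≡ end₁ i × end₂ j ≡ end₂ i) ⊎ (end₁ j ≡ end₂ i × end₂ j ≡ end₁ i) → i ≡ j
  same-pair {i} {j} ends = pair-injective n (ordered-pair-unique (pair-< n i) (pair-< n j) ends)

  choice : ∀ i → Choice (end₁ i) (end₂ i)
  choice i = choose (end₁ i) (end₂ i)

  facePoint : Fin m → Point n
  facePoint i = clusterCut (_∈ᵇ cluster (choice i))

  facePoint-∈X : ∀ i → InX T (facePoint i)
  facePoint-∈X i = listCut-∈X T (cluster-convex (choice i))

  facePoint-tight : ∀ i → lhs (facePoint i) ≡ rhs (facePoint i)
  facePoint-tight i = convex-tight (cluster-convex (choice i)) (cluster-tight (choice i))

  routeOf : Fin m → List (Fin n)
  routeOf i = route (end₁ i) (end₂ i)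

  -- Distinct pairs have distinct routes (same-ends), and a route plus a node pendant at one of its
  -- inner nodes is never a route (pendant-not-path); the second summand breaks the remaining ties.
  rank : Fin m → ℕ
  rank i = size (routeOf i) + size (cluster (choice i))

  joined : Fin m → Fin m → Bool
  joined = joins facePoint end₁ end₂

  joined-∈ : ∀ {i j} → joined j i ≡ true →
    end₁ i ∈ cluster (choice j) × end₂ i ∈ cluster (choice j)
  joined-∈ {i} {j} joined≡true = ∈ᵇ⇒∈ (∧-conicalˡ _ _ both) , ∈ᵇ⇒∈ (∧-conicalʳ _ _ both)
    where
    W : Fin n → Bool
    W = _∈ᵇ cluster (choice j)
    both : W (end₁ i) ∧ W (end₂ i) ≡ true
    both = trans (sym (trans (cong not (clusterCut-≢ W (end₁≢end₂ i))) (not-involutive _)))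
                 joined≡true

  ∈-joined : ∀ {i j} → end₁ i ∈ cluster (choice j) → end₂ i ∈ cluster (choice j) →
    joined j i ≡ true
  ∈-joined {i} {j} a∈ b∈
    rewrite clusterCut-≢ (_∈ᵇ cluster (choice j)) (end₁≢end₂ i) | ∈⇒∈ᵇ a∈ | ∈⇒∈ᵇ b∈ = refl

  joined-diag : ∀ {i j} → joined j i ≡ true → joined j j ≡ true
  joined-diag {i} {j} joined≡true with cluster-ends (choice j) (proj₁ (joined-∈ {i} {j} joined≡true))
  ... | a∈ , b∈ = ∈-joined {j} {j} a∈ b∈

  routes-distinct : ∀ {i j} → j ≢ i → routeOf j ⊆ routeOf i → routeOf i ⊆ routeOf j → ⊥
  routes-distinct {i} {j} j≢i Rj⊆Ri Ri⊆Rj = j≢i (same-pair (same-ends (route-path _ _) (route-path _ _)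
    (Rj⊆Ri (route-start∈ _ _)) (Rj⊆Ri (route-end∈ _ _))
    (Ri⊆Rj (route-start∈ _ _)) (Ri⊆Rj (route-end∈ _ _))))

  rank-increases : ∀ {i j} → j ≢ i → joined i i ≡ true → joined j i ≡ true → rank i < rank j
  rank-increases {i} {j} j≢i joined-ii joined-ji with joined-∈ {i} {j} joined-ji
  ... | a∈ , b∈ = size-route+cluster-< (choice i) (choice j) (proj₁ (joined-∈ {i} {i} joined-ii))
                    (cluster-convex (choice j) (route-path _ _) a∈ b∈) (routes-distinct j≢i)

  rank≤ : ∀ i → rank i ≤ n + n
  rank≤ i = +-mono-≤ (size≤ (routeOf i)) (size≤ (cluster (choice i)))

  InnerPair-unordered : ∀ {a b a′ b′} → InnerPair a b → InnerPair a′ b′ →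
    (a′ ≡ a × b′ ≡ b) ⊎ (a′ ≡ b × b′ ≡ a)
  InnerPair-unordered (inj₁ (refl , refl)) (inj₁ (refl , refl)) = inj₁ (refl , refl)
  InnerPair-unordered (inj₁ (refl , refl)) (inj₂ (refl , refl)) = inj₂ (refl , refl)
  InnerPair-unordered (inj₂ (refl , refl)) (inj₁ (refl , refl)) = inj₂ (refl , refl)
  InnerPair-unordered (inj₂ (refl , refl)) (inj₂ (refl , refl)) = inj₁ (refl , refl)

  unjoined-unique : ∀ {i j} → joined i i ≡ false → joined j j ≡ false → i ≡ j
  unjoined-unique {i} {j} unjoined-i unjoined-j =
    same-pair (InnerPair-unordered (singleton-ends unjoined-i) (singleton-ends unjoined-j))
    where
    singleton-ends : ∀ {k} → joined k k ≡ false → InnerPair (end₁ k) (end₂ k)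
    singleton-ends {k} unjoined = empty-cluster (choice k) λ a∈ →
      case trans (sym (uncurry (∈-joined {k} {k}) (cluster-ends (choice k) a∈))) unjoined of λ ()

  facePoints-independent : AffinelyIndependent m facePoint
  facePoints-independent = triangular⇒affinelyIndependent facePoint end₁ end₂ end₁≢end₂
    rank (n + n) rank≤ joined-diag rank-increases unjoined-unique

lemma9 : (n : ℕ) (T : Tree n) (u u′ v′ v : Fin n) (q : List (Fin n)) →
    IsPath (Tree.adj T) u v (u ∷ u′ ∷ (q ++ (v′ ∷ [ v ]))) →
    FacetDefining T
      (λ x → b2n (x u v) + b2n (x u′ v′))
      (λ x → b2n (x u v′) + b2n (x u′ v))
lemma9 n T u u′ v′ v q P0 =
    valid
  , (innerCut , innerCut-∈X , innerCut-untight)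
  , (facePoint , facePoint-∈X , facePoint-tight , facePoints-independent)
  where open Facet T u u′ v′ v q P0
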